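{- Let $\epsilon>0$ and $\delta>0$ be sufficiently small, and consider nine rectangle item types with (width, height): type 1: $(1/4-300\delta,\,1/6-2\epsilon)$; type 2: $(1/4+100\delta,\,1/6-2\epsilon)$; type 3: $(1/2+200\delta,\,1/6-2\epsilon)$; type 4: $(1/4-30\delta,\,1/3+\epsilon)$; type 5: $(1/4+10\delta,\,1/3+\epsilon)$; type 6: $(1/2+20\delta,\,1/3+\epsilon)$; type 7: $(1/4-3\delta,\,1/2+\epsilon)$; type 8: $(1/4+\delta,\,1/2+\epsilon)$; type 9: $(1/2+2\delta,\,1/2+\epsilon)$. Let $(\lambda_1,\dots,\lambda_9)=\frac{1}{413}(48,48,96,72,72,144,72,72,144)$ and for a pattern $p$ let $w(p)=\sum_{i=2}^{9}\lambda_i p_i$. Then over all patterns $p\in T_5$, the pattern $(0,0,0,0,3,0,4,0,0)$ maximizes $w(p)$.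
   Context: A pattern is a vector $p=(p_1,\dots,p_9)$ of nonnegative integers such that a multiset consisting of $p_i$ items of type $i$ ($i=1,\dots,9$) can be packed into the unit square bin: items placed axis-parallel in the given orientation (no rotation), inside $[0,1]^2$, with pairwise disjoint interiors. $T_j$ denotes the set of patterns whose first nonzero component is $p_j$ (i.e. whose smallest item type index used is $j$).
   Formalization: The parameters ε and δ range over the positive rationals, and items in a packing are placed at rational coordinates. -}

module Defs where

open import Data.Nat using (ℕ; zero; suc)
open import Data.Integer using (+_)
open import Data.Rational using (ℚ; _/_; _+_; _-_; _*_; _≤_; _<_; 0ℚ; 1ℚ)
open import Data.Fin using (Fin; zero; suc)
open import Data.Product using (Σ; _×_; _,_)
open import Data.Sum using (_⊎_)
open import Relation.Binary.PropositionalEquality using (_≡_; _≢_)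

infix 10 _÷_
_÷_ : ℕ → (d : ℕ) → .{{_ : Data.Nat.NonZero d}} → ℚ
n ÷ d = + n / d

ℕ→ℚ : ℕ → ℚ
ℕ→ℚ n = + n / 1

-- A pattern: number of items of each of the 9 types (type i+1 is index i).
Pattern : Set
Pattern = Fin 9 → ℕ

width : (δ : ℚ) → Fin 9 → ℚ
width δ zero                                                  = 1 ÷ 4 - 300 ÷ 1 * δ
width δ (suc zero)                                            = 1 ÷ 4 + 100 ÷ 1 * δ
width δ (suc (suc zero))                                      = 1 ÷ 2 + 200 ÷ 1 * δ
width δ (suc (suc (suc zero)))                                = 1 ÷ 4 - 30 ÷ 1 * δ
width δ (suc (suc (suc (suc zero))))                          = 1 ÷ 4 + 10 ÷ 1 * δ
width δ (suc (suc (suc (suc (suc zero)))))                    = 1 ÷ 2 + 20 ÷ 1 * δ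
width δ (suc (suc (suc (suc (suc (suc zero))))))              = 1 ÷ 4 - 3 ÷ 1 * δ
width δ (suc (suc (suc (suc (suc (suc (suc zero)))))))        = 1 ÷ 4 + δ
width δ (suc (suc (suc (suc (suc (suc (suc (suc zero)))))))) = 1 ÷ 2 + 2 ÷ 1 * δ

height : (ε : ℚ) → Fin 9 → ℚ
height ε zero                                                  = 1 ÷ 6 - 2 ÷ 1 * ε
height ε (suc zero)                                            = 1 ÷ 6 - 2 ÷ 1 * ε
height ε (suc (suc zero))                                      = 1 ÷ 6 - 2 ÷ 1 * ε
height ε (suc (suc (suc zero)))                                = 1 ÷ 3 + ε
height ε (suc (suc (suc (suc zero))))                          = 1 ÷ 3 + ε
height ε (suc (suc (suc (suc (suc zero)))))                    = 1 ÷ 3 + ε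
height ε (suc (suc (suc (suc (suc (suc zero))))))              = 1 ÷ 2 + ε
height ε (suc (suc (suc (suc (suc (suc (suc zero)))))))        = 1 ÷ 2 + ε
height ε (suc (suc (suc (suc (suc (suc (suc (suc zero)))))))) = 1 ÷ 2 + ε

Item : Pattern → Set
Item p = Σ (Fin 9) (λ i → Fin (p i))

itemType : {p : Pattern} → Item p → Fin 9
itemType (i , _) = i

-- A packing of the multiset described by p into [0,1]^2 (no rotation):
-- each item gets the lower-left corner (x,y) of its axis-parallel rectangle,
-- every rectangle lies inside the unit square, and two distinct items have
-- disjoint interiors (i.e. they are separated horizontally or vertically).
record Packing (ε δ : ℚ) (p : Pattern) : Set where
  field
    x y : Item p → ℚ
    x-lo : ∀ a → 0ℚ ≤ x a
    x-hi : ∀ a → x a + width δ (itemType a) ≤ 1ℚ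
    y-lo : ∀ a → 0ℚ ≤ y a
    y-hi : ∀ a → y a + height ε (itemType a) ≤ 1ℚ
    disjoint : ∀ a b → a ≢ b →
      (x a + width δ (itemType a) ≤ x b) ⊎
      (x b + width δ (itemType b) ≤ x a) ⊎
      (y a + height ε (itemType a) ≤ y b) ⊎
      (y b + height ε (itemType b) ≤ y a)

IsPattern : ℚ → ℚ → Pattern → Set
IsPattern ε δ p = Packing ε δ p

InT5 : Pattern → Set
InT5 p = (p zero ≡ 0) × (p (suc zero) ≡ 0) × (p (suc (suc zero)) ≡ 0)
       × (p (suc (suc (suc zero))) ≡ 0) × (p (suc (suc (suc (suc zero)))) ≢ 0)

lam : Fin 9 → ℚ
lam zero                                                  = 48 ÷ 413
lam (suc zero)                                            = 48 ÷ 413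
lam (suc (suc zero))                                      = 96 ÷ 413
lam (suc (suc (suc zero)))                                = 72 ÷ 413
lam (suc (suc (suc (suc zero))))                          = 72 ÷ 413
lam (suc (suc (suc (suc (suc zero)))))                    = 144 ÷ 413
lam (suc (suc (suc (suc (suc (suc zero))))))              = 72 ÷ 413
lam (suc (suc (suc (suc (suc (suc (suc zero)))))))        = 72 ÷ 413
lam (suc (suc (suc (suc (suc (suc (suc (suc zero)))))))) = 144 ÷ 413

w : Pattern → ℚ
w p = term (suc zero)
    + term (suc (suc zero))
    + term (suc (suc (suc zero)))
    + term (suc (suc (suc (suc zero))))
    + term (suc (suc (suc (suc (suc zero)))))
    + term (suc (suc (suc (suc (suc (suc zero))))))
    + term (suc (suc (suc (suc (suc (suc (suc zero)))))))
    + term (suc (suc (suc (suc (suc (suc (suc (suc zero))))))))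
  where
  term : Fin 9 → ℚ
  term i = lam i * ℕ→ℚ (p i)

pStar : Pattern
pStar (suc (suc (suc (suc zero))))             = 3
pStar (suc (suc (suc (suc (suc (suc zero)))))) = 4
pStar _                                         = 0

-- Every item of a pattern in T5 has type 5–9 and hence height more than 1/3, so it crosses one of
-- the lines y = 1/3, y = 2/3; items crossing the same line are horizontally disjoint, so their
-- widths add up to at most 1. Measure widths in units of the type-7 width 1/4 − 3δ: an item of
-- type 5, 7 or 8 is at least one unit wide and one of type 6 or 9 at least two. Five units exceed
-- width 1, and so do four units when one of them is a type-5 item, which is 13δ wider than a unit.
-- Some type-5 item crosses one of the lines, so the two lines carry at most 3 + 4 = 7 units. On T5
-- the weight is 72/413 per unit, and (0,0,0,0,3,0,4,0,0), a row of three type-5 items under a row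
-- of four type-7 items, packs and has 7 units.

module Submission where

open import Defs
open import Data.Rational using (ℚ; _≤_; _<_; 0ℚ)
open import Data.Product using (Σ; _×_)

open import Algebra.Bundles using (CommutativeMonoid)
import Algebra.Properties.CommutativeSemigroup as CommutativeSemigroup
open import Data.Empty using (⊥; ⊥-elim)
open import Data.Fin using (Fin; zero; suc; toℕ; fromℕ<)
open import Data.Fin.Properties using (¬Fin0; toℕ<n; toℕ-injective)
import Data.Integer as ℤ
import Data.Integer.Properties as ℤₚ
open import Data.List using (List; []; _∷_; _++_; map; length; filter; concatMap; allFin)
import Data.List.Properties as List
open import Data.List.Membership.Propositional using (_∈_)
open import Data.List.Membership.Propositional.Properties using (∈-map⁺; ∈-map⁻; ∈-allFin; ∈-concat⁺′; ∈-filter⁺)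
open import Data.List.Relation.Binary.Disjoint.Propositional using (Disjoint)
open import Data.List.Relation.Unary.All as All using (All; []; _∷_)
import Data.List.Relation.Unary.All.Properties as All
open import Data.List.Relation.Unary.AllPairs as AllPairs using (AllPairs; []; _∷_)
import Data.List.Relation.Unary.AllPairs.Properties as AllPairs
open import Data.List.Relation.Unary.Any using (here; there)
open import Data.List.Relation.Unary.Unique.Propositional using (Unique)
import Data.List.Relation.Unary.Unique.Propositional.Properties as Unique
open import Data.Nat as ℕ using (ℕ; zero; suc; z≤n; s≤s)
open import Data.Nat.ListAction using (sum)
import Data.Nat.ListAction.Properties as ℕ-List
import Data.Nat.Properties as ℕₚ
open import Data.Product using (_,_; proj₁)
open import Data.Rational using (1ℚ; _+_; _*_; _-_; -_; positive; nonPositive; toℚᵘ)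
open import Data.Rational.Properties as ℚₚ
  using (_≤?_; _<?_; ≤-refl; ≤-trans; <-≤-trans; <⇒≤; <-irrefl; +-mono-≤; +-monoʳ-≤; +-mono-≤-<)
open import Data.Rational.Solver using (module +-*-Solver)
import Data.Rational.Unnormalised as ℚᵘ
import Data.Rational.Unnormalised.Properties as ℚᵘₚ
open import Data.Sum using (_⊎_; inj₁; inj₂; [_,_]; map₂)
open import Data.Unit using (⊤)
open import Data.Vec using ([]; _∷_)
open import Function using (_∘_; id)
open import Level using (0ℓ)
open import Relation.Binary.Definitions using (tri<; tri≈; tri>)
open import Relation.Binary.PropositionalEquality
  using (_≡_; _≢_; refl; sym; trans; cong; cong₂; subst; subst₂; module ≡-Reasoning)
open import Relation.Nullary using (¬_; yes; no)
open import Relation.Nullary.Decidable using (True; toWitness; _×-dec_)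
open import Relation.Unary using (Pred; Decidable)
open import Relation.Unary.Properties using (∁?)

open import Algebra.Properties.Monoid.Mult ℚₚ.+-0-monoid using () renaming (_×_ to _·_; ×-homo-+ to ·-homo-+)
open +-*-Solver using (Polynomial; ⟦_⟧; ⟦_⟧↓; prove; solve; con; var; _:+_; _:*_; _:-_; _:×_; _:=_)

private
  module ℕ+ = CommutativeSemigroup ℕₚ.+-commutativeSemigroup
  module ℚ+ = CommutativeSemigroup (CommutativeMonoid.commutativeSemigroup ℚₚ.+-0-commutativeMonoid)

sumℚ : {A : Set} → (A → ℚ) → List A → ℚ
sumℚ f []       = 0ℚ
sumℚ f (a ∷ as) = f a + sumℚ f as

module _ {A : Set} {P : Pred A 0ℓ} (P? : Decidable P) (f : A → ℚ) where

  sumℚ-partition : ∀ as → sumℚ f as ≡ sumℚ f (filter P? as) + sumℚ f (filter (∁? P?) as)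
  sumℚ-partition []       = sym (ℚₚ.+-identityˡ 0ℚ)
  sumℚ-partition (a ∷ as) with P? a
  ... | yes _ = trans (cong (f a +_) (sumℚ-partition as)) (sym (ℚₚ.+-assoc (f a) (sumℚ f (filter P? as)) _))
  ... | no  _ = trans (cong (f a +_) (sumℚ-partition as)) (ℚ+.x∙yz≈y∙xz (f a) (sumℚ f (filter P? as)) _)

private module _ (x l r : ℕ) {s : ℕ} (s≤l+r : s ℕ.≤ l ℕ.+ r) where

  +-≤-regroupˡ : x ℕ.+ s ℕ.≤ (x ℕ.+ l) ℕ.+ r
  +-≤-regroupˡ = subst (x ℕ.+ s ℕ.≤_) (sym (ℕₚ.+-assoc x l r)) (ℕₚ.+-monoʳ-≤ x s≤l+r)

  +-≤-regroupʳ : x ℕ.+ s ℕ.≤ l ℕ.+ (x ℕ.+ r)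
  +-≤-regroupʳ = subst (x ℕ.+ s ℕ.≤_) (ℕ+.x∙yz≈y∙xz x l r) (ℕₚ.+-monoʳ-≤ x s≤l+r)

  +-≤-regroup : x ℕ.+ s ℕ.≤ (x ℕ.+ l) ℕ.+ (x ℕ.+ r)
  +-≤-regroup = ℕₚ.≤-trans +-≤-regroupˡ (ℕₚ.+-monoʳ-≤ (x ℕ.+ l) (ℕₚ.m≤n+m r x))

module _ {A : Set} {P Q : Pred A 0ℓ} (P? : Decidable P) (Q? : Decidable Q) (f : A → ℕ) where

  sum-≤-cover : ∀ {as} → All (λ a → P a ⊎ Q a) as →
                sum (map f as) ℕ.≤ sum (map f (filter P? as)) ℕ.+ sum (map f (filter Q? as))
  sum-≤-cover [] = z≤n
  sum-≤-cover {a ∷ as} (P∪Q ∷ cover) with P? a | Q? a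
  ... | yes _ | yes _ = +-≤-regroup  (f a) (sum (map f (filter P? as))) _ (sum-≤-cover cover)
  ... | yes _ | no  _ = +-≤-regroupˡ (f a) (sum (map f (filter P? as))) _ (sum-≤-cover cover)
  ... | no  _ | yes _ = +-≤-regroupʳ (f a) (sum (map f (filter P? as))) _ (sum-≤-cover cover)
  ... | no ¬P | no ¬Q = ⊥-elim ([ ¬P , ¬Q ] P∪Q)

sum-const : ∀ {A : Set} (x : ℕ) (as : List A) → sum (map (λ _ → x) as) ≡ length as ℕ.* x
sum-const x []       = refl
sum-const x (_ ∷ as) = cong (x ℕ.+_) (sum-const x as)

allPairs-restrict : ∀ {A : Set} {P : A → Set} {R S : A → A → Set} →
                    (∀ {a b} → P a → P b → R a b → S a b) →
                    ∀ {as} → All P as → AllPairs R as → AllPairs S as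
allPairs-restrict f []         []         = []
allPairs-restrict f (Pa ∷ Pas) (Ras ∷ R*) =
  All.zipWith (λ (Pb , Rab) → f Pa Pb Rab) (Pas , Ras) ∷ allPairs-restrict f Pas R*

-- ℕ→ℚ n is a normalised fraction, so the computation is done on the plain fraction n / 1 in ℚᵘ.
ℕ→ℚ-suc : ∀ n → ℕ→ℚ (suc n) ≡ 1ℚ + ℕ→ℚ n
ℕ→ℚ-suc n = ℚₚ.toℚᵘ-injective (begin
  toℚᵘ (ℕ→ℚ (suc n))              ≈⟨ ℚₚ.toℚᵘ-fromℚᵘ (ℚᵘ.mkℚᵘ (ℤ.+ suc n) 0) ⟩
  ℚᵘ.mkℚᵘ (ℤ.+ suc n) 0           ≈⟨ ℚᵘ.*≡* (cong (λ k → (ℤ.+ 1 ℤ.+ k) ℤ.* ℤ.+ 1) (sym (ℤₚ.*-identityʳ (ℤ.+ n)))) ⟩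
  ℚᵘ.1ℚᵘ ℚᵘ.+ ℚᵘ.mkℚᵘ (ℤ.+ n) 0   ≈⟨ ℚᵘₚ.+-congʳ ℚᵘ.1ℚᵘ (ℚᵘₚ.≃-sym (ℚₚ.toℚᵘ-fromℚᵘ (ℚᵘ.mkℚᵘ (ℤ.+ n) 0))) ⟩
  toℚᵘ 1ℚ ℚᵘ.+ toℚᵘ (ℕ→ℚ n)       ≈⟨ ℚᵘₚ.≃-sym (ℚₚ.toℚᵘ-homo-+ 1ℚ (ℕ→ℚ n)) ⟩
  toℚᵘ (1ℚ + ℕ→ℚ n)               ∎)
  where open import Relation.Binary.Reasoning.Setoid ℚᵘₚ.≃-setoid

ℕ→ℚ-+ : ∀ m n → ℕ→ℚ (m ℕ.+ n) ≡ ℕ→ℚ m + ℕ→ℚ n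
ℕ→ℚ-+ zero    n = sym (ℚₚ.+-identityˡ (ℕ→ℚ n))
ℕ→ℚ-+ (suc m) n = begin
  ℕ→ℚ (suc (m ℕ.+ n))          ≡⟨ ℕ→ℚ-suc (m ℕ.+ n) ⟩
  1ℚ + ℕ→ℚ (m ℕ.+ n)           ≡⟨ cong (1ℚ +_) (ℕ→ℚ-+ m n) ⟩
  1ℚ + (ℕ→ℚ m + ℕ→ℚ n)         ≡⟨ sym (ℚₚ.+-assoc 1ℚ (ℕ→ℚ m) (ℕ→ℚ n)) ⟩
  (1ℚ + ℕ→ℚ m) + ℕ→ℚ n         ≡⟨ cong (_+ ℕ→ℚ n) (sym (ℕ→ℚ-suc m)) ⟩
  ℕ→ℚ (suc m) + ℕ→ℚ n          ∎
  where open ≡-Reasoning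

ℕ→ℚ-* : ∀ m n → ℕ→ℚ (m ℕ.* n) ≡ ℕ→ℚ m * ℕ→ℚ n
ℕ→ℚ-* zero    n = sym (ℚₚ.*-zeroˡ (ℕ→ℚ n))
ℕ→ℚ-* (suc m) n = begin
  ℕ→ℚ (n ℕ.+ m ℕ.* n)          ≡⟨ ℕ→ℚ-+ n (m ℕ.* n) ⟩
  ℕ→ℚ n + ℕ→ℚ (m ℕ.* n)        ≡⟨ cong (ℕ→ℚ n +_) (ℕ→ℚ-* m n) ⟩
  ℕ→ℚ n + ℕ→ℚ m * ℕ→ℚ n        ≡⟨ solve 2 (λ m n → n :+ m :* n := (con 1ℚ :+ m) :* n) refl (ℕ→ℚ m) (ℕ→ℚ n) ⟩
  (1ℚ + ℕ→ℚ m) * ℕ→ℚ n         ≡⟨ cong (_* ℕ→ℚ n) (sym (ℕ→ℚ-suc m)) ⟩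
  ℕ→ℚ (suc m) * ℕ→ℚ n          ∎
  where open ≡-Reasoning

ℕ→ℚ-mono-≤ : ∀ {m n} → m ℕ.≤ n → ℕ→ℚ m ≤ ℕ→ℚ n
ℕ→ℚ-mono-≤ {n = n} z≤n = ℚₚ.nonNegative⁻¹ (ℕ→ℚ n) {{ℚₚ.normalize-nonNeg n 1}}
ℕ→ℚ-mono-≤ {suc m} {suc n} (s≤s m≤n) =
  subst₂ _≤_ (sym (ℕ→ℚ-suc m)) (sym (ℕ→ℚ-suc n)) (+-monoʳ-≤ 1ℚ (ℕ→ℚ-mono-≤ m≤n))

ℕ→ℚ-sum-* : ∀ {A : Set} (f g : A → ℕ) as →
            ℕ→ℚ (sum (map (λ a → f a ℕ.* g a) as)) ≡ sumℚ (λ a → ℕ→ℚ (f a) * ℕ→ℚ (g a)) as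
ℕ→ℚ-sum-* f g []       = refl
ℕ→ℚ-sum-* f g (a ∷ as) = trans (ℕ→ℚ-+ (f a ℕ.* g a) _) (cong₂ _+_ (ℕ→ℚ-* (f a) (g a)) (ℕ→ℚ-sum-* f g as))

·-nonNeg : ∀ n {x} → 0ℚ ≤ x → 0ℚ ≤ n · x
·-nonNeg zero    0≤x = ≤-refl
·-nonNeg (suc n) 0≤x = +-mono-≤ 0≤x (·-nonNeg n 0≤x)

·-monoˡ-≤ : ∀ {x} → 0ℚ ≤ x → ∀ {m n} → m ℕ.≤ n → m · x ≤ n · x
·-monoˡ-≤ 0≤x {n = n} z≤n   = ·-nonNeg n 0≤x
·-monoˡ-≤ {x} 0≤x (s≤s m≤n) = +-monoʳ-≤ x (·-monoˡ-≤ 0≤x m≤n)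

-- Disjoint intervals and slot counting

module Intervals {A : Set} (left len : A → ℚ) where

  Apart : A → A → Set
  Apart a b = left a + len a ≤ left b ⊎ left b + len b ≤ left a

  Within : ℚ → ℚ → A → Set
  Within c d a = c ≤ left a × left a + len a ≤ d

  private
    LeftOf : A → A → Set
    LeftOf h a = left a + len a ≤ left h

    LeftOf? : ∀ h → Decidable (LeftOf h)
    LeftOf? h a = left a + len a ≤? left h

    right-of : ∀ {c d h a} → Within c d a → Apart h a → ¬ LeftOf h a → Within (left h + len h) d a
    right-of (_ , a≤d) (inj₁ h≤a) _      = h≤a , a≤d
    right-of _         (inj₂ a≤h) ¬a≤h = ⊥-elim (¬a≤h a≤h)

    -- The head h splits the other intervals into those left of h and those right of it; the
    -- recursion is on a length bound n because both parts are filtered sublists.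
    fits : ∀ n as {c d} → length as ℕ.≤ n → c ≤ d → All (Within c d) as → AllPairs Apart as →
           c + sumℚ len as ≤ d
    fits _       []       _ c≤d _ _ = subst (_≤ _) (sym (ℚₚ.+-identityʳ _)) c≤d
    fits (suc n) (h ∷ as) {c} {d} (s≤s |as|≤n) c≤d ((c≤h , h≤d) ∷ within) (h-apart ∷ apart) = begin
      c + (len h + sumℚ len as)          ≡⟨ cong (λ s → c + (len h + s)) (sumℚ-partition (LeftOf? h) len as) ⟩
      c + (len h + (sumℚ len L + sumℚ len R))
        ≡⟨ solve 4 (λ c w l r → c :+ (w :+ (l :+ r)) := ((c :+ l) :+ w) :+ r) refl c (len h) (sumℚ len L) (sumℚ len R) ⟩
      ((c + sumℚ len L) + len h) + sumℚ len R
        ≤⟨ +-mono-≤ (+-mono-≤ (fits n L (shorter (LeftOf? h)) c≤h within-L (AllPairs.filter⁺ (LeftOf? h) apart)) ≤-refl) ≤-refl ⟩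
      (left h + len h) + sumℚ len R
        ≤⟨ fits n R (shorter (∁? (LeftOf? h))) h≤d within-R (AllPairs.filter⁺ (∁? (LeftOf? h)) apart) ⟩
      d                                  ∎
      where
      open ℚₚ.≤-Reasoning
      L R : List A
      L = filter (LeftOf? h) as
      R = filter (∁? (LeftOf? h)) as
      shorter : ∀ {P : Pred A 0ℓ} (P? : Decidable P) → length (filter P? as) ℕ.≤ n
      shorter P? = ℕₚ.≤-trans (List.length-filter P? as) |as|≤n
      within-L : All (Within c (left h)) L
      within-L = All.zipWith (λ ((c≤a , _) , a≤h) → c≤a , a≤h)
                   (All.filter⁺ (LeftOf? h) within , All.all-filter (LeftOf? h) as)
      within-R : All (Within (left h + len h) d) R
      within-R = All.zipWith (λ ((w , ap) , ¬l) → right-of w ap ¬l)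
                   (All.filter⁺ (∁? (LeftOf? h)) (All.zip (within , h-apart)) , All.all-filter (∁? (LeftOf? h)) as)

  apart-within-fits : ∀ {c d} as → c ≤ d → All (Within c d) as → AllPairs Apart as → c + sumℚ len as ≤ d
  apart-within-fits as = fits (length as) as ℕₚ.≤-refl

module _ {A : Set} (slots : A → ℕ) (len : A → ℚ) (unit : ℚ) where

  slots·unit≤sum : ∀ {as} → All (λ a → slots a · unit ≤ len a) as → sum (map slots as) · unit ≤ sumℚ len as
  slots·unit≤sum []                  = ≤-refl
  slots·unit≤sum {a ∷ as} (a≥ ∷ as≥) = begin
    (slots a ℕ.+ sum (map slots as)) · unit      ≡⟨ ·-homo-+ unit (slots a) _ ⟩
    slots a · unit + sum (map slots as) · unit   ≤⟨ +-mono-≤ a≥ (slots·unit≤sum as≥) ⟩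
    len a + sumℚ len as                          ∎
    where open ℚₚ.≤-Reasoning

  slots·unit+surplus≤sum : ∀ {a₀ as e} → a₀ ∈ as → slots a₀ · unit + e ≤ len a₀ →
                           All (λ a → slots a · unit ≤ len a) as → sum (map slots as) · unit + e ≤ sumℚ len as
  slots·unit+surplus≤sum {_} {a ∷ as} {e} (here refl) a₀≥ (_ ∷ as≥) = begin
    (slots a ℕ.+ sum (map slots as)) · unit + e        ≡⟨ cong (_+ e) (·-homo-+ unit (slots a) _) ⟩
    (slots a · unit + sum (map slots as) · unit) + e   ≡⟨ ℚ+.xy∙z≈xz∙y (slots a · unit) _ e ⟩
    (slots a · unit + e) + sum (map slots as) · unit   ≤⟨ +-mono-≤ a₀≥ (slots·unit≤sum as≥) ⟩
    len a + sumℚ len as                                ∎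
    where open ℚₚ.≤-Reasoning
  slots·unit+surplus≤sum {_} {a ∷ as} {e} (there a₀∈as) a₀≥ (a≥ ∷ as≥) = begin
    (slots a ℕ.+ sum (map slots as)) · unit + e        ≡⟨ cong (_+ e) (·-homo-+ unit (slots a) _) ⟩
    (slots a · unit + sum (map slots as) · unit) + e   ≡⟨ ℚₚ.+-assoc (slots a · unit) _ e ⟩
    slots a · unit + (sum (map slots as) · unit + e)   ≤⟨ +-mono-≤ a≥ (slots·unit+surplus≤sum a₀∈as a₀≥ as≥) ⟩
    len a + sumℚ len as                                ∎
    where open ℚₚ.≤-Reasoning

slot-count-bound : ∀ {unit e m n} → 0ℚ ≤ unit → m · unit + e ≤ 1ℚ → 1ℚ < n · unit + e → m ℕ.< n
slot-count-bound {unit} {e} {m} {n} 0≤unit m·unit+e≤1 1<n·unit+e with m ℕ.<? n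
... | yes m<n = m<n
... | no  m≮n = ⊥-elim (<-irrefl refl (<-≤-trans 1<n·unit+e
                  (≤-trans (ℚₚ.+-monoˡ-≤ e (·-monoˡ-≤ 0≤unit (ℕₚ.≮⇒≥ m≮n))) m·unit+e≤1)))

module _ {n : ℕ} (p : Fin n → ℕ) where

  private
    Copy : Set
    Copy = Σ (Fin n) (λ i → Fin (p i))

    copy : ∀ i → Fin (p i) → Copy
    copy i k = i , k

    block : Fin n → List Copy
    block i = map (copy i) (allFin (p i))

    ∈-block⇒type : ∀ {i a} → a ∈ block i → proj₁ a ≡ i
    ∈-block⇒type a∈ with ∈-map⁻ _ a∈
    ... | _ , _ , refl = refl

    block-unique : ∀ i → Unique (block i)
    block-unique i = Unique.map⁺ (λ { refl → refl }) (Unique.allFin⁺ (p i))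

    blocks-disjoint : ∀ {i j} → i ≢ j → Disjoint (block i) (block j)
    blocks-disjoint i≢j (a∈i , a∈j) = i≢j (trans (sym (∈-block⇒type a∈i)) (∈-block⇒type a∈j))

    block-sum : ∀ (f : Fin n → ℕ) i → sum (map (f ∘ proj₁) (block i)) ≡ f i ℕ.* p i
    block-sum f i = begin
      sum (map (f ∘ proj₁) (block i))                     ≡⟨ cong sum (sym (List.map-∘ {g = f ∘ proj₁} {f = copy i} (allFin (p i)))) ⟩
      sum (map (λ _ → f i) (allFin (p i)))                ≡⟨ sum-const (f i) (allFin (p i)) ⟩
      length (allFin (p i)) ℕ.* f i                       ≡⟨ cong (ℕ._* f i) (List.length-tabulate {n = p i} id) ⟩
      p i ℕ.* f i                                         ≡⟨ ℕₚ.*-comm (p i) (f i) ⟩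
      f i ℕ.* p i                                         ∎
      where open ≡-Reasoning

    blocks-sum : ∀ (f : Fin n → ℕ) is → sum (map (f ∘ proj₁) (concatMap block is)) ≡ sum (map (λ i → f i ℕ.* p i) is)
    blocks-sum f []       = refl
    blocks-sum f (i ∷ is) = begin
      sum (map (f ∘ proj₁) (block i ++ concatMap block is))                        ≡⟨ cong sum (List.map-++ (f ∘ proj₁) (block i) _) ⟩
      sum (map (f ∘ proj₁) (block i) ++ map (f ∘ proj₁) (concatMap block is))      ≡⟨ ℕ-List.sum-++ (map (f ∘ proj₁) (block i)) _ ⟩
      sum (map (f ∘ proj₁) (block i)) ℕ.+ sum (map (f ∘ proj₁) (concatMap block is)) ≡⟨ cong₂ ℕ._+_ (block-sum f i) (blocks-sum f is) ⟩
      f i ℕ.* p i ℕ.+ sum (map (λ i → f i ℕ.* p i) is)                            ∎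
      where open ≡-Reasoning

  items : List Copy
  items = concatMap block (allFin n)

  ∈-items : ∀ a → a ∈ items
  ∈-items (i , k) = ∈-concat⁺′ (∈-map⁺ (copy i) (∈-allFin k)) (∈-map⁺ block (∈-allFin i))

  items-unique : Unique items
  items-unique = Unique.concat⁺ (All.map⁺ (All.universal block-unique (allFin n)))
                                (AllPairs.map⁺ (AllPairs.map blocks-disjoint (Unique.allFin⁺ n)))

  sum-items : ∀ (f : Fin n → ℕ) → sum (map (f ∘ proj₁) items) ≡ sum (map (λ i → f i ℕ.* p i) (allFin n))
  sum-items f = blocks-sum f (allFin n)

-- Horizontal lines through a packing

Straddles : ℚ → ℚ → ℚ → Set
Straddles c y h = y < c × c < y + h

straddles-a-third : ∀ {y h} → 0ℚ ≤ y → y + h ≤ 1ℚ → 1 ÷ 3 < h →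
                    Straddles (1 ÷ 3) y h ⊎ Straddles (2 ÷ 3) y h
straddles-a-third {y} {h} 0≤y y+h≤1 ⅓<h with y <? 1 ÷ 3 | y <? 2 ÷ 3
... | yes y<⅓ | _       = inj₁ (y<⅓ , <-≤-trans ⅓<h (subst (_≤ y + h) (ℚₚ.+-identityˡ h) (ℚₚ.+-monoˡ-≤ h 0≤y)))
... | no  y≮⅓ | yes y<⅔ = inj₂ (y<⅔ , +-mono-≤-< (ℚₚ.≮⇒≥ y≮⅓) ⅓<h)
... | no  _   | no  y≮⅔ = ⊥-elim (<-irrefl refl (<-≤-trans (+-mono-≤-< (ℚₚ.≮⇒≥ y≮⅔) ⅓<h) y+h≤1))

module Lines {ε δ : ℚ} {p : Pattern} (P : Packing ε δ p) where
  open Packing P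
  open Intervals x (width δ ∘ itemType) public

  Crosses : ℚ → Item p → Set
  Crosses c a = Straddles c (y a) (height ε (itemType a))

  crosses? : ∀ c → Decidable (Crosses c)
  crosses? c a = (y a <? c) ×-dec (c <? y a + height ε (itemType a))

  crossing-apart : ∀ {c a b} → Crosses c a → Crosses c b → a ≢ b → Apart a b
  crossing-apart {c} {a} {b} (a<c , c<a) (b<c , c<b) a≢b with disjoint a b a≢b
  ... | inj₁ a≤b               = inj₁ a≤b
  ... | inj₂ (inj₁ b≤a)        = inj₂ b≤a
  ... | inj₂ (inj₂ (inj₁ a≤b)) = ⊥-elim (<-irrefl refl (ℚₚ.<-trans (<-≤-trans c<a a≤b) b<c))
  ... | inj₂ (inj₂ (inj₂ b≤a)) = ⊥-elim (<-irrefl refl (ℚₚ.<-trans (<-≤-trans c<b b≤a) a<c))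

  line : ℚ → List (Item p)
  line c = filter (crosses? c) (items p)

  line-fits : ∀ c → sumℚ (width δ ∘ itemType) (line c) ≤ 1ℚ
  line-fits c = subst (_≤ 1ℚ) (ℚₚ.+-identityˡ _) (apart-within-fits (line c) (toWitness {a? = 0ℚ ≤? 1ℚ} _)
    (All.universal (λ a → x-lo a , x-hi a) (line c))
    (allPairs-restrict crossing-apart (All.all-filter (crosses? c) (items p)) (Unique.filter⁺ (crosses? c) (items-unique p))))

-- Any η < 1/120 would do: the binding constraint is that three type-5 items fit side by side.
η : ℚ
η = 1 ÷ 200

module SmallParameter (v : ℚ) (0<v : 0ℚ < v) (v<η : v < η) where

  affine-pos : ∀ c k → 0ℚ ≤ c → 0ℚ < c + k * η → 0ℚ < c + k * v
  affine-pos c k 0≤c 0<c+kη with k ≤? 0ℚ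
  ... | yes k≤0 = <-≤-trans 0<c+kη (+-monoʳ-≤ c (ℚₚ.*-monoˡ-≤-nonPos k {{nonPositive k≤0}} (<⇒≤ v<η)))
  ... | no  k≰0 = +-mono-≤-< 0≤c (ℚₚ.positive⁻¹ (k * v)
                    {{ℚₚ.pos*pos⇒pos k {{positive (ℚₚ.≰⇒> k≰0)}} v {{positive 0<v}}}})

  -- b − a is the affine function c + k v, positive on (0, η] by the two decided sign conditions;
  -- the identity b = a + (c + k v) is checked on normal forms of polynomials in v.
  <-by-affine : ∀ (a b : Polynomial 1) c k →
                ⟦ b ⟧↓ (v ∷ []) ≡ ⟦ a :+ (con c :+ con k :* var zero) ⟧↓ (v ∷ []) →
                True (0ℚ ≤? c) → True (0ℚ <? c + k * η) → ⟦ a ⟧ (v ∷ []) < ⟦ b ⟧ (v ∷ [])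
  <-by-affine a b c k b≡a+c+kv 0≤c 0<c+kη =
    subst₂ _<_ (ℚₚ.+-identityʳ (⟦ a ⟧ (v ∷ []))) (sym (prove (v ∷ []) b (a :+ (con c :+ con k :* var zero)) b≡a+c+kv))
      (ℚₚ.+-monoʳ-< (⟦ a ⟧ (v ∷ [])) (affine-pos c k (toWitness 0≤c) (toWitness 0<c+kη)))

pattern T5 = suc (suc (suc (suc zero)))
pattern T6 = suc (suc (suc (suc (suc zero))))
pattern T7 = suc (suc (suc (suc (suc (suc zero)))))
pattern T8 = suc (suc (suc (suc (suc (suc (suc zero))))))
pattern T9 = suc (suc (suc (suc (suc (suc (suc (suc zero)))))))

Large : Fin 9 → Set
Large (suc (suc (suc (suc _)))) = ⊤
Large _                         = ⊥

slots : Fin 9 → ℕ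
slots T5 = 1
slots T6 = 2
slots T7 = 1
slots T8 = 1
slots T9 = 2
slots _  = 0

slotTotal : Pattern → ℕ
slotTotal p = sum (map (λ i → slots i ℕ.* p i) (allFin 9))

-- ⟦ widthₚ i ⟧ (δ ∷ []) is width δ i and ⟦ heightₚ i ⟧ (ε ∷ []) is height ε i by definition, for large i.
widthₚ heightₚ : Fin 9 → Polynomial 1
widthₚ T5 = con (1 ÷ 4) :+ con (10 ÷ 1) :* var zero
widthₚ T6 = con (1 ÷ 2) :+ con (20 ÷ 1) :* var zero
widthₚ T7 = con (1 ÷ 4) :- con (3 ÷ 1) :* var zero
widthₚ T8 = con (1 ÷ 4) :+ var zero
widthₚ T9 = con (1 ÷ 2) :+ con (2 ÷ 1) :* var zero
widthₚ _  = con 0ℚ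
heightₚ T5 = con (1 ÷ 3) :+ var zero
heightₚ T6 = con (1 ÷ 3) :+ var zero
heightₚ T7 = con (1 ÷ 2) :+ var zero
heightₚ T8 = con (1 ÷ 2) :+ var zero
heightₚ T9 = con (1 ÷ 2) :+ var zero
heightₚ _  = con 0ℚ

module Widths (δ : ℚ) (0<δ : 0ℚ < δ) (δ<η : δ < η) where
  open SmallParameter δ 0<δ δ<η

  unit surplus : ℚ
  unit    = width δ T7
  surplus = width δ T5 - unit

  unit-nonNeg : 0ℚ ≤ unit
  unit-nonNeg = <⇒≤ (<-by-affine (con 0ℚ) (widthₚ T7) (1 ÷ 4) (- 3 ÷ 1) refl _ _)

  type5-nonNeg : 0ℚ ≤ width δ T5
  type5-nonNeg = <⇒≤ (<-by-affine (con 0ℚ) (widthₚ T5) (1 ÷ 4) (10 ÷ 1) refl _ _)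

  slots·unit≤width : ∀ i → Large i → slots i · unit ≤ width δ i
  slots·unit≤width T5 _ = <⇒≤ (<-by-affine (1 :× widthₚ T7) (widthₚ T5) 0ℚ (13 ÷ 1) refl _ _)
  slots·unit≤width T6 _ = <⇒≤ (<-by-affine (2 :× widthₚ T7) (widthₚ T6) 0ℚ (26 ÷ 1) refl _ _)
  slots·unit≤width T7 _ = ℚₚ.≤-reflexive (ℚₚ.+-identityʳ unit)
  slots·unit≤width T8 _ = <⇒≤ (<-by-affine (1 :× widthₚ T7) (widthₚ T8) 0ℚ (4 ÷ 1) refl _ _)
  slots·unit≤width T9 _ = <⇒≤ (<-by-affine (2 :× widthₚ T7) (widthₚ T9) 0ℚ (8 ÷ 1) refl _ _)

  slots·unit+surplus≤type5 : slots T5 · unit + surplus ≤ width δ T5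
  slots·unit+surplus≤type5 = ℚₚ.≤-reflexive (solve 2 (λ u w → (u :+ con 0ℚ) :+ (w :- u) := w) refl unit (width δ T5))

  five-units-too-wide : 1ℚ < 5 · unit + 0ℚ
  five-units-too-wide = <-by-affine (con 1ℚ) (5 :× widthₚ T7 :+ con 0ℚ) (1 ÷ 4) (- 15 ÷ 1) refl _ _

  four-units-and-surplus-too-wide : 1ℚ < 4 · unit + surplus
  four-units-and-surplus-too-wide =
    <-by-affine (con 1ℚ) (4 :× widthₚ T7 :+ (widthₚ T5 :- widthₚ T7)) 0ℚ 1ℚ refl _ _

  three-type5-fit : 3 · width δ T5 ≤ 1ℚ
  three-type5-fit = <⇒≤ (<-by-affine (3 :× widthₚ T5) (con 1ℚ) (1 ÷ 4) (- 30 ÷ 1) refl _ _)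

  four-type7-fit : 4 · unit ≤ 1ℚ
  four-type7-fit = <⇒≤ (<-by-affine (4 :× widthₚ T7) (con 1ℚ) 0ℚ (12 ÷ 1) refl _ _)

module Heights (ε : ℚ) (0<ε : 0ℚ < ε) (ε<η : ε < η) where
  open SmallParameter ε 0<ε ε<η

  large-is-tall : ∀ i → Large i → 1 ÷ 3 < height ε i
  large-is-tall T5 _ = <-by-affine (con (1 ÷ 3)) (heightₚ T5) 0ℚ 1ℚ refl _ _
  large-is-tall T6 _ = <-by-affine (con (1 ÷ 3)) (heightₚ T6) 0ℚ 1ℚ refl _ _
  large-is-tall T7 _ = <-by-affine (con (1 ÷ 3)) (heightₚ T7) (1 ÷ 6) 1ℚ refl _ _
  large-is-tall T8 _ = <-by-affine (con (1 ÷ 3)) (heightₚ T8) (1 ÷ 6) 1ℚ refl _ _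
  large-is-tall T9 _ = <-by-affine (con (1 ÷ 3)) (heightₚ T9) (1 ÷ 6) 1ℚ refl _ _

  large-height-nonNeg : ∀ i → Large i → 0ℚ ≤ height ε i
  large-height-nonNeg i large = ≤-trans (toWitness {a? = 0ℚ ≤? 1 ÷ 3} _) (<⇒≤ (large-is-tall i large))

  type5-on-type7-fit : height ε T5 + height ε T7 ≤ 1ℚ
  type5-on-type7-fit = <⇒≤ (<-by-affine (heightₚ T5 :+ heightₚ T7) (con 1ℚ) (1 ÷ 6) (- 2 ÷ 1) refl _ _)

-- The packing of pStar

slot-fits : ∀ {w} → 0ℚ ≤ w → ∀ {j n} → j ℕ.< n → j · w + w ≤ n · w
slot-fits {w} 0≤w {j} j<n = subst (_≤ _) (ℚₚ.+-comm w (j · w)) (·-monoˡ-≤ 0≤w j<n)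

slots-apart : ∀ {w} → 0ℚ ≤ w → ∀ {j k} → j ≢ k → j · w + w ≤ k · w ⊎ k · w + w ≤ j · w
slots-apart 0≤w {j} {k} j≢k with ℕₚ.<-cmp j k
... | tri< j<k _ _ = inj₁ (slot-fits 0≤w j<k)
... | tri≈ _ j≡k _ = ⊥-elim (j≢k j≡k)
... | tri> _ _ k<j = inj₂ (slot-fits 0≤w k<j)

data StarItem : Item pStar → Set where
  bottom : (k : Fin 3) → StarItem (T5 , k)
  top    : (k : Fin 4) → StarItem (T7 , k)

starItem : ∀ a → StarItem a
starItem (T5 , k) = bottom k
starItem (T7 , k) = top k
starItem (zero , ())
starItem (suc zero , ())
starItem (suc (suc zero) , ())
starItem (suc (suc (suc zero)) , ())
starItem (T6 , ())
starItem (T8 , ())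
starItem (T9 , ())

module StarPacking (ε δ : ℚ) (0<ε : 0ℚ < ε) (ε<η : ε < η) (0<δ : 0ℚ < δ) (δ<η : δ < η) where
  open Widths δ 0<δ δ<η
  open Heights ε 0<ε ε<η

  x y : Item pStar → ℚ
  x (i , k) = toℕ k · width δ i
  y (T7 , _) = height ε T5
  y _        = 0ℚ

  x-lo : ∀ a → 0ℚ ≤ x a
  x-lo a with starItem a
  ... | bottom k = ·-nonNeg (toℕ k) type5-nonNeg
  ... | top    k = ·-nonNeg (toℕ k) unit-nonNeg

  x-hi : ∀ a → x a + width δ (itemType a) ≤ 1ℚ
  x-hi a with starItem a
  ... | bottom k = ≤-trans (slot-fits type5-nonNeg (toℕ<n k)) three-type5-fit
  ... | top    k = ≤-trans (slot-fits unit-nonNeg (toℕ<n k)) four-type7-fit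

  y-lo : ∀ a → 0ℚ ≤ y a
  y-lo a with starItem a
  ... | bottom _ = ≤-refl
  ... | top    _ = large-height-nonNeg T5 _

  y-hi : ∀ a → y a + height ε (itemType a) ≤ 1ℚ
  y-hi a with starItem a
  ... | bottom _ = ≤-trans (ℚₚ.+-monoˡ-≤ (height ε T5) (large-height-nonNeg T7 _))
                     (subst (_≤ 1ℚ) (ℚₚ.+-comm (height ε T5) (height ε T7)) type5-on-type7-fit)
  ... | top    _ = type5-on-type7-fit

  disjoint : ∀ a b → a ≢ b →
             (x a + width δ (itemType a) ≤ x b) ⊎ (x b + width δ (itemType b) ≤ x a) ⊎
             (y a + height ε (itemType a) ≤ y b) ⊎ (y b + height ε (itemType b) ≤ y a)
  disjoint a b a≢b with starItem a | starItem b
  ... | bottom k | bottom l = map₂ inj₁ (slots-apart type5-nonNeg (a≢b ∘ cong (T5 ,_) ∘ toℕ-injective))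
  ... | top    k | top    l = map₂ inj₁ (slots-apart unit-nonNeg (a≢b ∘ cong (T7 ,_) ∘ toℕ-injective))
  ... | bottom _ | top    _ = inj₂ (inj₂ (inj₁ (ℚₚ.≤-reflexive (ℚₚ.+-identityˡ (height ε T5)))))
  ... | top    _ | bottom _ = inj₂ (inj₂ (inj₂ (ℚₚ.≤-reflexive (ℚₚ.+-identityˡ (height ε T5)))))

  packing : IsPattern ε δ pStar
  packing = record { x = x ; y = y ; x-lo = x-lo ; x-hi = x-hi ; y-lo = y-lo ; y-hi = y-hi ; disjoint = disjoint }

pStar∈T5 : InT5 pStar
pStar∈T5 = refl , refl , refl , refl , λ ()

InT5⇒large : ∀ {p} → InT5 p → (a : Item p) → Large (itemType a)
InT5⇒large (p₁≡0 , _)                (zero , k)                    = ⊥-elim (¬Fin0 (subst Fin p₁≡0 k))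
InT5⇒large (_ , p₂≡0 , _)            (suc zero , k)                = ⊥-elim (¬Fin0 (subst Fin p₂≡0 k))
InT5⇒large (_ , _ , p₃≡0 , _)        (suc (suc zero) , k)          = ⊥-elim (¬Fin0 (subst Fin p₃≡0 k))
InT5⇒large (_ , _ , _ , p₄≡0 , _)    (suc (suc (suc zero)) , k)    = ⊥-elim (¬Fin0 (subst Fin p₄≡0 k))
InT5⇒large _                         (suc (suc (suc (suc _))) , _) = _

type5Item : ∀ {p} → InT5 p → Item p
type5Item (_ , _ , _ , _ , p₅≢0) = T5 , fromℕ< (ℕₚ.n≢0⇒n>0 p₅≢0)

module SlotCount (ε δ : ℚ) (0<ε : 0ℚ < ε) (ε<η : ε < η) (0<δ : 0ℚ < δ) (δ<η : δ < η)
                 (p : Pattern) (p∈T5 : InT5 p) (P : IsPattern ε δ p) where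
  open Packing P
  open Lines P
  open Widths δ 0<δ δ<η
  open Heights ε 0<ε ε<η

  large : (a : Item p) → Large (itemType a)
  large = InT5⇒large p∈T5

  crosses-a-line : ∀ a → Crosses (1 ÷ 3) a ⊎ Crosses (2 ÷ 3) a
  crosses-a-line a = straddles-a-third (y-lo a) (y-hi a) (large-is-tall (itemType a) (large a))

  slotCount : List (Item p) → ℕ
  slotCount as = sum (map (slots ∘ itemType) as)

  private
    wide-enough : ∀ c → All (λ a → slots (itemType a) · unit ≤ width δ (itemType a)) (line c)
    wide-enough c = All.universal (λ a → slots·unit≤width (itemType a) (large a)) (line c)

  line-slots<5 : ∀ c → slotCount (line c) ℕ.< 5
  line-slots<5 c = slot-count-bound unit-nonNeg
    (subst (_≤ 1ℚ) (sym (ℚₚ.+-identityʳ _)) (≤-trans (slots·unit≤sum (slots ∘ itemType) (width δ ∘ itemType) unit (wide-enough c)) (line-fits c)))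
    five-units-too-wide

  line-slots<4 : ∀ {c a} → a ∈ line c → itemType a ≡ T5 → slotCount (line c) ℕ.< 4
  line-slots<4 {c} a∈ refl = slot-count-bound unit-nonNeg
    (≤-trans (slots·unit+surplus≤sum (slots ∘ itemType) (width δ ∘ itemType) unit a∈ slots·unit+surplus≤type5 (wide-enough c)) (line-fits c))
    four-units-and-surplus-too-wide

  slot-count≤7 : slotCount (items p) ℕ.≤ 7
  slot-count≤7 = ℕₚ.≤-trans (sum-≤-cover (crosses? (1 ÷ 3)) (crosses? (2 ÷ 3)) (slots ∘ itemType) (All.universal crosses-a-line (items p)))
                            (lines-bound (crosses-a-line a₀))
    where
    a₀ : Item p
    a₀ = type5Item p∈T5
    on-line : ∀ {c} → Crosses c a₀ → a₀ ∈ line c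
    on-line = ∈-filter⁺ (crosses? _) (∈-items p a₀)
    lines-bound : Crosses (1 ÷ 3) a₀ ⊎ Crosses (2 ÷ 3) a₀ → slotCount (line (1 ÷ 3)) ℕ.+ slotCount (line (2 ÷ 3)) ℕ.≤ 7
    lines-bound (inj₁ a₀-crosses) = ℕₚ.+-mono-≤ (ℕₚ.≤-pred (line-slots<4 (on-line a₀-crosses) refl)) (ℕₚ.≤-pred (line-slots<5 _))
    lines-bound (inj₂ a₀-crosses) = ℕₚ.+-mono-≤ (ℕₚ.≤-pred (line-slots<5 _)) (ℕₚ.≤-pred (line-slots<4 (on-line a₀-crosses) refl))

  slotTotal≤7 : slotTotal p ℕ.≤ 7
  slotTotal≤7 = subst (ℕ._≤ 7) (sum-items p slots) slot-count≤7

-- The entries of the pattern are abstracted as a₁ … a₉ so that the vanishing ones can be matched with refl.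
private
  weights-proportional : ∀ a₁ a₂ a₃ a₄ a₅ a₆ a₇ a₈ a₉ → a₁ ≡ 0 → a₂ ≡ 0 → a₃ ≡ 0 → a₄ ≡ 0 →
    48 ÷ 413 * ℕ→ℚ a₂ + 96 ÷ 413 * ℕ→ℚ a₃ + 72 ÷ 413 * ℕ→ℚ a₄ + 72 ÷ 413 * ℕ→ℚ a₅
      + 144 ÷ 413 * ℕ→ℚ a₆ + 72 ÷ 413 * ℕ→ℚ a₇ + 72 ÷ 413 * ℕ→ℚ a₈ + 144 ÷ 413 * ℕ→ℚ a₉
    ≡ 72 ÷ 413 * (0ℚ * ℕ→ℚ a₁ + (0ℚ * ℕ→ℚ a₂ + (0ℚ * ℕ→ℚ a₃ + (0ℚ * ℕ→ℚ a₄ + (1ℚ * ℕ→ℚ a₅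
      + (2 ÷ 1 * ℕ→ℚ a₆ + (1ℚ * ℕ→ℚ a₇ + (1ℚ * ℕ→ℚ a₈ + (2 ÷ 1 * ℕ→ℚ a₉ + 0ℚ)))))))))
  weights-proportional _ _ _ _ a₅ a₆ a₇ a₈ a₉ refl refl refl refl = solve 5 (λ a b c d e →
      con (48 ÷ 413) :* con 0ℚ :+ con (96 ÷ 413) :* con 0ℚ :+ con (72 ÷ 413) :* con 0ℚ :+ con (72 ÷ 413) :* a
        :+ con (144 ÷ 413) :* b :+ con (72 ÷ 413) :* c :+ con (72 ÷ 413) :* d :+ con (144 ÷ 413) :* e
      := con (72 ÷ 413) :* (con 0ℚ :* con 0ℚ :+ (con 0ℚ :* con 0ℚ :+ (con 0ℚ :* con 0ℚ :+ (con 0ℚ :* con 0ℚ :+ (con 1ℚ :* a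
        :+ (con (2 ÷ 1) :* b :+ (con 1ℚ :* c :+ (con 1ℚ :* d :+ (con (2 ÷ 1) :* e :+ con 0ℚ))))))))))
      refl (ℕ→ℚ a₅) (ℕ→ℚ a₆) (ℕ→ℚ a₇) (ℕ→ℚ a₈) (ℕ→ℚ a₉)

weight-by-slots : ∀ p → InT5 p → w p ≡ 72 ÷ 413 * ℕ→ℚ (slotTotal p)
weight-by-slots p (p₁≡0 , p₂≡0 , p₃≡0 , p₄≡0 , _) = begin
  w p                                                              ≡⟨ weights-proportional (p zero) (p (suc zero)) (p (suc (suc zero)))
                                                                        (p (suc (suc (suc zero)))) (p T5) (p T6) (p T7) (p T8) (p T9)
                                                                        p₁≡0 p₂≡0 p₃≡0 p₄≡0 ⟩
  72 ÷ 413 * sumℚ (λ i → ℕ→ℚ (slots i) * ℕ→ℚ (p i)) (allFin 9)     ≡⟨ cong (72 ÷ 413 *_) (sym (ℕ→ℚ-sum-* slots p (allFin 9))) ⟩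
  72 ÷ 413 * ℕ→ℚ (slotTotal p)                                    ∎
  where open ≡-Reasoning

lemma4 : Σ ℚ (λ η → (0ℚ < η) × ((ε δ : ℚ) → 0ℚ < ε → ε < η → 0ℚ < δ → δ < η →
    (InT5 pStar × IsPattern ε δ pStar)
    × ((p : Pattern) → InT5 p → IsPattern ε δ p → w p ≤ w pStar)))
lemma4 = η , toWitness {a? = 0ℚ <? η} _ , λ ε δ 0<ε ε<η 0<δ δ<η →
  (pStar∈T5 , StarPacking.packing ε δ 0<ε ε<η 0<δ δ<η) ,
  λ p p∈T5 P → begin
    w p                             ≡⟨ weight-by-slots p p∈T5 ⟩
    72 ÷ 413 * ℕ→ℚ (slotTotal p)   ≤⟨ ℚₚ.*-monoˡ-≤-nonNeg (72 ÷ 413)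
                                         (ℕ→ℚ-mono-≤ (SlotCount.slotTotal≤7 ε δ 0<ε ε<η 0<δ δ<η p p∈T5 P)) ⟩
    72 ÷ 413 * ℕ→ℚ 7                ≡⟨ weight-by-slots pStar pStar∈T5 ⟨
    w pStar                         ∎
  where open ℚₚ.≤-Reasoning
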